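{- The sub-operad $\mathcal{BWT}$ of $\mathcal{BWTS}$ generated by the three trees (i) the one-node tree labelled $\{1,2\}$, (ii) the tree with root labelled $\{1\}$ and one child labelled $\{2\}$, (iii) the tree with root labelled $\{2\}$ and one child labelled $\{1\}$, has as elements exactly the recursively labelled red and white trees with no empty nodes (no node with an empty label set).
   Context: A red and white tree of weight $n$: rooted tree with unordered children, each node carrying a (possibly empty) set of labels, label sets disjoint with union $\{1,\dots,n\}$, unlabelled (empty) nodes having at least two children; labelled nodes are white, an empty node is red iff all its children are white. It is recursively labelled if for every node the set of labels in its subtree is an interval of $\{1,\dots,n\}$. Composition $T_1\circ_xT_2$ ($T_2$ of weight $k$, $x$ a label of $T_1$ in node $z$): relabel $y>x$ in $T_1$ as $y+k-1$, add $x-1$ to labels of $T_2$; (W) root of $T_2$ not red: erase $x$ from $z$, add root labels of $T_2$ to $z$, make root's children children of $z$; (R1) root of $T_2$ red and $T_1$ the one-node tree $\{x\}$: result $T_2$; (R2) root of $T_2$ red and $z$ not a leaf or with at least two labels: remove $x$ from $z$, attach root of $T_2$ as child of $z$; (R3) root of $T_2$ red and $z$ a non-root leaf with sole label $x$: delete $z$, make children of root of $T_2$ children of the parent of $z$; $z$ is white if it ends without labels. $\mathcal{BWTS}$ is the set-operad (with unit the one-node tree $\{1\}$) generated by the three trees above together with the tree having a red empty root with leaves $\{1\},\{2\}$. -}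

module Defs where

open import Data.Nat using (ℕ; zero; suc; _+_; _∸_; _≤_; _<ᵇ_; _≡ᵇ_)
open import Data.Bool using (Bool; true; false; not; if_then_else_; _∧_)
open import Data.List using (List; []; _∷_; _++_; map; filterᵇ; upTo; length)
open import Data.Bool.ListAction using (any)
open import Data.Unit using (⊤)
open import Relation.Binary.PropositionalEquality using (_≡_)
open import Data.List.Relation.Unary.All using (All)
open import Data.List.Relation.Binary.Pointwise using (Pointwise)
open import Data.List.Relation.Binary.Permutation.Propositional using (_↭_)
open import Data.List.Membership.Propositional using (_∈_)
open import Data.Product using (_×_)
open import Relation.Nullary using (¬_)

-- Raw (ordered) rose trees; each node carries a list of labels
-- (read as a set).  Unordered-ness of children and of label sets is
-- handled by the isomorphism relation _≈_ below.

data Tree : Set where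
  node : List ℕ → List Tree → Tree

labelsOf : Tree → List ℕ
labelsOf (node l _) = l

childrenOf : Tree → List Tree
childrenOf (node _ cs) = cs

mutual
  flatten : Tree → List ℕ
  flatten (node l cs) = l ++ flattenList cs

  flattenList : List Tree → List ℕ
  flattenList []       = []
  flattenList (c ∷ cs) = flatten c ++ flattenList cs

mutual
  mapLabels : (ℕ → ℕ) → Tree → Tree
  mapLabels f (node l cs) = node (map f l) (mapLabelsList f cs)

  mapLabelsList : (ℕ → ℕ) → List Tree → List Tree
  mapLabelsList f []       = []
  mapLabelsList f (c ∷ cs) = mapLabels f c ∷ mapLabelsList f cs

-- Colours: labelled nodes are white; an empty node is red iff all of
-- its children are white.

mutual
  isRed : Tree → Bool
  isRed (node (_ ∷ _) _) = false
  isRed (node [] cs)     = allWhite cs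

  allWhite : List Tree → Bool
  allWhite []       = true
  allWhite (c ∷ cs) = not (isRed c) ∧ allWhite cs

data AllNodes (P : List ℕ → List Tree → Set) : Tree → Set where
  node : ∀ {l cs} → P l cs → All (AllNodes P) cs → AllNodes P (node l cs)

oneTo : ℕ → List ℕ
oneTo n = map suc (upTo n)

EmptyHasTwoChildren : List ℕ → List Tree → Set
EmptyHasTwoChildren []      cs = 2 ≤ length cs
EmptyHasTwoChildren (_ ∷ _) cs = ⊤

-- label sets disjoint with union {1..n}: the multiset of all labels is
-- exactly {1,...,n}
WellFormed : ℕ → Tree → Set
WellFormed n T = (flatten T ↭ oneTo n) × AllNodes EmptyHasTwoChildren T

data _≈_ : Tree → Tree → Set where
  node : ∀ {l l' cs ds ms} → l ↭ l' → cs ↭ ms → Pointwise _≈_ ms ds →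
         node l cs ≈ node l' ds

removeLabel : ℕ → List ℕ → List ℕ
removeLabel x = filterᵇ (λ y → not (y ≡ᵇ x))

hasLabel : ℕ → List ℕ → Bool
hasLabel x = any (_≡ᵇ x)

isSole : ℕ → List ℕ → Bool
isSole x (y ∷ []) = y ≡ᵇ x
isSole x _        = false

isLeaf : List Tree → Bool
isLeaf [] = true
isLeaf (_ ∷ _) = false

-- S is the already relabelled T₂, x the label being substituted.
module _ (x : ℕ) (S : Tree) where
  mutual
    -- operate on the subtree; the node z containing x is treated by
    -- (W) or (R2); case (R3) is handled at the parent in goList
    go : Tree → Tree
    go (node l cs) =
      if hasLabel x l
      then (if isRed S
            then node (removeLabel x l) (cs ++ S ∷ [])                      -- (R2)
            else node (removeLabel x l ++ labelsOf S) (cs ++ childrenOf S)) -- (W)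
      else node l (goList cs)

    goList : List Tree → List Tree
    goList [] = []
    goList (node l cs ∷ ts) =
      if isRed S ∧ isSole x l ∧ isLeaf cs
      then childrenOf S ++ goList ts                                        -- (R3)
      else go (node l cs) ∷ goList ts

  composeShifted : Tree → Tree
  composeShifted (node l cs) =
    if isRed S ∧ isSole x l ∧ isLeaf cs
    then S                                                                  -- (R1)
    else go (node l cs)

shiftAbove : ℕ → ℕ → ℕ → ℕ
shiftAbove x k y = if x <ᵇ y then y + k ∸ 1 else y

compose : (x k : ℕ) → Tree → Tree → Tree
compose x k T₁ T₂ =
  composeShifted x (mapLabels (λ y → y + (x ∸ 1)) T₂) (mapLabels (shiftAbove x k) T₁)

-- The sub-operad BWT of BWTS generated by the three trees, as a
-- predicate on (representatives of) trees of weight n.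

leaf : List ℕ → Tree
leaf l = node l []

data BWT : ℕ → Tree → Set where
  unit  : BWT 1 (leaf (1 ∷ []))
  gen₁  : BWT 2 (leaf (1 ∷ 2 ∷ []))
  gen₂  : BWT 2 (node (1 ∷ []) (leaf (2 ∷ []) ∷ []))
  gen₃  : BWT 2 (node (2 ∷ []) (leaf (1 ∷ []) ∷ []))
  comp  : ∀ {n k x T₁ T₂} → BWT n T₁ → BWT k T₂ → 1 ≤ x → x ≤ n →
          BWT (n + k ∸ 1) (compose x k T₁ T₂)
  iso   : ∀ {n T T'} → BWT n T → T ≈ T' → BWT n T'

IsInterval : List ℕ → Set
IsInterval L = ∀ i j m → i ∈ L → j ∈ L → i ≤ m → m ≤ j → m ∈ L

data RecursivelyLabelled : Tree → Set where
  node : ∀ {l cs} → IsInterval (flatten (node l cs)) →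
         All RecursivelyLabelled cs → RecursivelyLabelled (node l cs)

NonEmptyLabels : List ℕ → List Tree → Set
NonEmptyLabels l _ = ¬ (l ≡ [])

NoEmptyNodes : Tree → Set
NoEmptyNodes = AllNodes NonEmptyLabels

module Submission where

-- Soundness (⇒): every element of weight n is `Admissible` (recursively labelled,
-- no empty nodes, labels of a node absent below it, label set {1, …, n}).  This
-- holds for the generators, is invariant under isomorphism, and is preserved by
-- T₁ ∘ₓ T₂, where only rule (W) occurs since the root of T₂ is labelled.  The
-- labels coming from a subtree of T₁ with labels F are the z with unshift z ∈ F,
-- where the monotone map `unshift` collapses the labels of T₂ to x (module
-- `Shift`); so intervals are preserved (module `Substitution`).
--
-- Completeness (⇐): by strong induction on n, an `RLTree` (the trees on the
-- right, with distinct labels 1, …, n) is a composite of smaller ones: a child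
-- carrying an interval [a, a+d] of at least two labels is split off at a
-- (module `SplitBigChild`); otherwise a leaf {1}, a leaf {n} or the root label 1
-- is split off with {2}→{1}, {1}→{2} or {1,2}; weight 1 is the unit.

open import Defs
open import Data.Nat using (ℕ)
open import Data.Product using (_×_)
open import Function.Bundles using (_⇔_)

open import Data.Nat using (zero; suc; _+_; _∸_; _⊔_; _⊓_; _≤_; _<_; _<ᵇ_; _≡ᵇ_; _≤?_; _≟_; z≤n; s≤s)
open import Data.Nat.Properties
open import Data.Nat.Induction using (<-rec)
open import Data.Bool using (true; false; T)
open import Data.List using (List; []; _∷_; _++_; map)
open import Data.List.Properties using (map-++; map-∘; map-id-local; ++-assoc; ++-identityʳ)
open import Data.List.Relation.Unary.All as All using (All; []; _∷_)
open import Data.List.Relation.Unary.All.Properties using () renaming (++⁺ to All-++⁺)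
open import Data.List.Relation.Unary.Any using (Any; here; there)
open import Data.List.Relation.Unary.Unique.Propositional using (Unique)
open import Data.List.Relation.Unary.AllPairs using ([]; _∷_) renaming (tail to AllPairs-tail)
import Data.List.Relation.Unary.Unique.Propositional.Properties as Unique
open import Data.List.Relation.Unary.Unique.Propositional.Properties using (Unique[x∷xs]⇒x∉xs)
open import Data.List.Relation.Binary.Pointwise using (Pointwise; []; _∷_)
open import Data.List.Relation.Binary.Permutation.Propositional
  using (_↭_; ↭-sym; ↭-refl; ↭-trans; ↭⇒↭ₛ; refl; prep; swap; trans)
import Data.List.Relation.Binary.Permutation.Propositional.Properties as Perm
import Data.List.Relation.Binary.Permutation.Setoid.Properties as PermSetoid
open import Data.List.Relation.Binary.BagAndSetEquality using (∼bag⇒↭)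
open import Data.List.Membership.Propositional using (_∈_; _∉_; find)
open import Data.List.Relation.Binary.Subset.Propositional using (_⊆_)
open import Data.List.Membership.Propositional.Properties
  using (∈-++⁺ˡ; ∈-++⁺ʳ; ∈-++⁻; ∈-map⁺; ∈-map⁻; ∈-∃++; ∈-upTo⁺; ∈-upTo⁻)
open import Data.List.Membership.Propositional.Properties.WithK using (unique∧set⇒bag)
open import Data.Product using (Σ; _,_; proj₁; proj₂)
open import Data.Sum using (_⊎_; inj₁; inj₂; [_,_])
open import Data.Empty using (⊥; ⊥-elim)
open import Data.Unit using (⊤; tt)
open import Relation.Nullary using (¬_; yes; no)
open import Relation.Binary.PropositionalEquality
  using (_≡_; _≢_; refl; sym; cong; cong₂; subst; subst₂; setoid; module ≡-Reasoning)
  renaming (trans to ≡-trans)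
open import Function.Bundles using (mk⇔)
open import Function.Base using (_∘_; _∘′_; id)
open import Data.List.Extrema.Nat using (min; max; argmin-sel; argmax-sel; min≤⊤; min≤xs; ⊥≤max; xs≤max)

mutual
  flatten-mapLabels : ∀ f t → flatten (mapLabels f t) ≡ map f (flatten t)
  flatten-mapLabels f (node l cs) = begin
    map f l ++ flattenList (mapLabelsList f cs) ≡⟨ cong (map f l ++_) (flattenList-mapLabelsList f cs) ⟩
    map f l ++ map f (flattenList cs)           ≡⟨ map-++ f l (flattenList cs) ⟨
    map f (l ++ flattenList cs)                 ∎
    where open ≡-Reasoning

  flattenList-mapLabelsList : ∀ f cs → flattenList (mapLabelsList f cs) ≡ map f (flattenList cs)
  flattenList-mapLabelsList f [] = refl
  flattenList-mapLabelsList f (c ∷ cs) = begin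
    flatten (mapLabels f c) ++ flattenList (mapLabelsList f cs)
      ≡⟨ cong₂ _++_ (flatten-mapLabels f c) (flattenList-mapLabelsList f cs) ⟩
    map f (flatten c) ++ map f (flattenList cs)
      ≡⟨ map-++ f (flatten c) (flattenList cs) ⟨
    map f (flatten c ++ flattenList cs) ∎
    where open ≡-Reasoning

flattenList-++ : ∀ cs ds → flattenList (cs ++ ds) ≡ flattenList cs ++ flattenList ds
flattenList-++ [] ds = refl
flattenList-++ (c ∷ cs) ds =
  ≡-trans (cong (flatten c ++_) (flattenList-++ cs ds)) (sym (++-assoc (flatten c) (flattenList cs) (flattenList ds)))

∈-flattenList-++⁻ : ∀ cs {ds z} → z ∈ flattenList (cs ++ ds) → z ∈ flattenList cs ⊎ z ∈ flattenList ds
∈-flattenList-++⁻ cs {ds} z∈ = ∈-++⁻ (flattenList cs) (subst (_ ∈_) (flattenList-++ cs ds) z∈)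

∈-flattenList-++⁺ : ∀ cs {ds z} → z ∈ flattenList cs ⊎ z ∈ flattenList ds → z ∈ flattenList (cs ++ ds)
∈-flattenList-++⁺ cs {ds} z∈ =
  subst (_ ∈_) (sym (flattenList-++ cs ds)) ([ ∈-++⁺ˡ , ∈-++⁺ʳ (flattenList cs) ] z∈)

map-fixed : ∀ (f : ℕ → ℕ) l → (∀ {y} → y ∈ l → f y ≡ y) → map f l ≡ l
map-fixed f l fixed = map-id-local (All.tabulate fixed)

mutual
  mapLabels-fixed : ∀ f t → (∀ {y} → y ∈ flatten t → f y ≡ y) → mapLabels f t ≡ t
  mapLabels-fixed f (node l cs) fixed =
    cong₂ node (map-fixed f l (fixed ∘ ∈-++⁺ˡ)) (mapLabelsList-fixed f cs (fixed ∘ ∈-++⁺ʳ l))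

  mapLabelsList-fixed : ∀ f cs → (∀ {y} → y ∈ flattenList cs → f y ≡ y) → mapLabelsList f cs ≡ cs
  mapLabelsList-fixed f [] fixed = refl
  mapLabelsList-fixed f (c ∷ cs) fixed =
    cong₂ _∷_ (mapLabels-fixed f c (fixed ∘ ∈-++⁺ˡ)) (mapLabelsList-fixed f cs (fixed ∘ ∈-++⁺ʳ (flatten c)))

mutual
  mapLabels-∘ : ∀ f g t → mapLabels f (mapLabels g t) ≡ mapLabels (f ∘′ g) t
  mapLabels-∘ f g (node l cs) = cong₂ node (sym (map-∘ {g = f} {f = g} l)) (mapLabelsList-∘ f g cs)

  mapLabelsList-∘ : ∀ f g cs → mapLabelsList f (mapLabelsList g cs) ≡ mapLabelsList (f ∘′ g) cs
  mapLabelsList-∘ f g [] = refl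
  mapLabelsList-∘ f g (c ∷ cs) = cong₂ _∷_ (mapLabels-∘ f g c) (mapLabelsList-∘ f g cs)

-- Relabelling by g and then by a map undoing g on the labels gives back the tree;
-- this is how decompositions T ≡ T₁ ∘ₓ T₂ are verified in the completeness proof.
map-undo : ∀ (f g : ℕ → ℕ) l → (∀ {y} → y ∈ l → f (g y) ≡ y) → map f (map g l) ≡ l
map-undo f g l undo = ≡-trans (sym (map-∘ {g = f} {f = g} l)) (map-fixed (f ∘′ g) l undo)

mapLabels-undo : ∀ f g t → (∀ {y} → y ∈ flatten t → f (g y) ≡ y) → mapLabels f (mapLabels g t) ≡ t
mapLabels-undo f g t undo = ≡-trans (mapLabels-∘ f g t) (mapLabels-fixed (f ∘′ g) t undo)

mapLabelsList-undo : ∀ f g cs → (∀ {y} → y ∈ flattenList cs → f (g y) ≡ y) →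
                     mapLabelsList f (mapLabelsList g cs) ≡ cs
mapLabelsList-undo f g cs undo = ≡-trans (mapLabelsList-∘ f g cs) (mapLabelsList-fixed (f ∘′ g) cs undo)

≡ᵇ-true⇒≡ : ∀ {y x} → (y ≡ᵇ x) ≡ true → y ≡ x
≡ᵇ-true⇒≡ {y} {x} eq = ≡ᵇ⇒≡ y x (subst T (sym eq) tt)

≡ᵇ-false⇒≢ : ∀ {y x} → (y ≡ᵇ x) ≡ false → y ≢ x
≡ᵇ-false⇒≢ {y} {x} eq y≡x = subst T eq (≡⇒≡ᵇ y x y≡x)

≡ᵇ-refl : ∀ x → (x ≡ᵇ x) ≡ true
≡ᵇ-refl zero = refl
≡ᵇ-refl (suc x) = ≡ᵇ-refl x

hasLabel-true : ∀ x l → hasLabel x l ≡ true → x ∈ l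
hasLabel-true x (y ∷ l) h with y ≡ᵇ x in eq
... | true = here (sym (≡ᵇ-true⇒≡ eq))
... | false = there (hasLabel-true x l h)

hasLabel-false : ∀ x l → hasLabel x l ≡ false → x ∉ l
hasLabel-false x (y ∷ l) h x∈ with y ≡ᵇ x in eq
hasLabel-false x (y ∷ l) h (here x≡y) | false = ≡ᵇ-false⇒≢ eq (sym x≡y)
hasLabel-false x (y ∷ l) h (there x∈) | false = hasLabel-false x l h x∈

hasLabel-∉ : ∀ x l → x ∉ l → hasLabel x l ≡ false
hasLabel-∉ x l x∉ with hasLabel x l in eq
... | true = ⊥-elim (x∉ (hasLabel-true x l eq))
... | false = refl

removeLabel⁻ : ∀ {z} x l → z ∈ removeLabel x l → z ∈ l × z ≢ x
removeLabel⁻ x (y ∷ l) z∈ with y ≡ᵇ x in eq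
removeLabel⁻ x (y ∷ l) z∈ | true = let (z∈l , z≢x) = removeLabel⁻ x l z∈ in there z∈l , z≢x
removeLabel⁻ x (y ∷ l) (here refl) | false = here refl , ≡ᵇ-false⇒≢ eq
removeLabel⁻ x (y ∷ l) (there z∈) | false = let (z∈l , z≢x) = removeLabel⁻ x l z∈ in there z∈l , z≢x

removeLabel⁺ : ∀ {z} x l → z ∈ l → z ≢ x → z ∈ removeLabel x l
removeLabel⁺ x (y ∷ l) z∈ z≢x with y ≡ᵇ x in eq
removeLabel⁺ x (y ∷ l) (here refl) z≢x | true = ⊥-elim (z≢x (≡ᵇ-true⇒≡ eq))
removeLabel⁺ x (y ∷ l) (there z∈) z≢x | true = removeLabel⁺ x l z∈ z≢x
removeLabel⁺ x (y ∷ l) (here refl) z≢x | false = here refl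
removeLabel⁺ x (y ∷ l) (there z∈) z≢x | false = there (removeLabel⁺ x l z∈ z≢x)

-- Convexity of a predicate on ℕ; `IsInterval L` is convexity of membership in L,
-- so it only depends on the members of L.
Convex : (ℕ → Set) → Set
Convex P = ∀ i j m → P i → P j → i ≤ m → m ≤ j → P m

interval-from-convex : ∀ {P : ℕ → Set} L → (∀ {z} → z ∈ L → P z) → (∀ {z} → P z → z ∈ L) →
                       Convex P → IsInterval L
interval-from-convex L to from convex i j m i∈ j∈ i≤m m≤j = from (convex i j m (to i∈) (to j∈) i≤m m≤j)

singleton-interval : ∀ y → IsInterval (y ∷ [])
singleton-interval y i j m (here refl) (here refl) y≤m m≤y rewrite ≤-antisym y≤m m≤y = here refl

Spans : List ℕ → ℕ → ℕ → Set
Spans L lo hi = (∀ {z} → z ∈ L → lo ≤ z × z ≤ hi) × (∀ {z} → lo ≤ z → z ≤ hi → z ∈ L)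

span-interval : ∀ {L lo hi} → Spans L lo hi → IsInterval L
span-interval {L} (to , from) =
  interval-from-convex L to (λ (lo≤z , z≤hi) → from lo≤z z≤hi)
    (λ i j m (lo≤i , _) (_ , j≤hi) i≤m m≤j → ≤-trans lo≤i i≤m , ≤-trans m≤j j≤hi)

Spans-↭ : ∀ {L L' lo hi} → L ↭ L' → Spans L lo hi → Spans L' lo hi
Spans-↭ L↭ (to , from) =
  (λ z∈ → to (Perm.∈-resp-↭ (↭-sym L↭) z∈)) , (λ lo≤z z≤hi → Perm.∈-resp-↭ L↭ (from lo≤z z≤hi))

Spans-oneTo : ∀ n → Spans (oneTo n) 1 n
Spans-oneTo n = to , from
  where
  to : ∀ {z} → z ∈ oneTo n → 1 ≤ z × z ≤ n
  to z∈ with ∈-map⁻ suc z∈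
  ... | i , i∈ , refl = s≤s z≤n , ∈-upTo⁻ i∈
  from : ∀ {z} → 1 ≤ z → z ≤ n → z ∈ oneTo n
  from {suc i} _ i<n = ∈-map⁺ suc (∈-upTo⁺ i<n)

interval-translate : ∀ c L → IsInterval L → IsInterval (map (λ y → y + c) L)
interval-translate c L iv i j m i∈ j∈ i≤m m≤j with ∈-map⁻ (λ y → y + c) i∈ | ∈-map⁻ (λ y → y + c) j∈
... | y₁ , y₁∈ , refl | y₂ , y₂∈ , refl =
  subst (_∈ map (λ y → y + c) L) (m∸n+n≡m c≤m)
    (∈-map⁺ (λ y → y + c) (iv y₁ y₂ (m ∸ c) y₁∈ y₂∈ y₁≤ ≤y₂))
  where
  c≤m : c ≤ m
  c≤m = ≤-trans (m≤n+m c y₁) i≤m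
  y₁≤ : y₁ ≤ m ∸ c
  y₁≤ = m+n≤o⇒m≤o∸n y₁ i≤m
  ≤y₂ : m ∸ c ≤ y₂
  ≤y₂ = m≤n+o⇒m∸n≤o m c (≤-trans m≤j (≤-reflexive (+-comm y₂ c)))

Spans-translate : ∀ c {L lo hi} → Spans L lo hi → Spans (map (λ y → y + c) L) (lo + c) (hi + c)
Spans-translate c {L} {lo} {hi} (to , from) = to' , from'
  where
  to' : ∀ {z} → z ∈ map (λ y → y + c) L → lo + c ≤ z × z ≤ hi + c
  to' z∈ with ∈-map⁻ (λ y → y + c) z∈
  ... | y , y∈ , refl = let (lo≤y , y≤hi) = to y∈ in +-monoˡ-≤ c lo≤y , +-monoˡ-≤ c y≤hi
  from' : ∀ {z} → lo + c ≤ z → z ≤ hi + c → z ∈ map (λ y → y + c) L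
  from' {z} lo+c≤z z≤hi+c =
    subst (_∈ map (λ y → y + c) L) (m∸n+n≡m c≤z)
      (∈-map⁺ (λ y → y + c)
        (from (m+n≤o⇒m≤o∸n lo lo+c≤z) (m≤n+o⇒m∸n≤o z c (subst (z ≤_) (+-comm hi c) z≤hi+c))))
    where
    c≤z : c ≤ z
    c≤z = ≤-trans (m≤n+m c lo) lo+c≤z

flattenList-↭ : ∀ {cs ms} → cs ↭ ms → flattenList cs ↭ flattenList ms
flattenList-↭ refl = ↭-refl
flattenList-↭ (prep c p) = Perm.++⁺ˡ (flatten c) (flattenList-↭ p)
flattenList-↭ (swap a b p) =
  ↭-trans (Perm.shifts (flatten a) (flatten b)) (Perm.++⁺ˡ (flatten b) (Perm.++⁺ˡ (flatten a) (flattenList-↭ p)))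
flattenList-↭ (trans p q) = ↭-trans (flattenList-↭ p) (flattenList-↭ q)

mutual
  flatten-≈ : ∀ {t t'} → t ≈ t' → flatten t ↭ flatten t'
  flatten-≈ (node l↭ cs↭ pw) = Perm.++⁺ l↭ (↭-trans (flattenList-↭ cs↭) (flattenList-pointwise pw))

  flattenList-pointwise : ∀ {ms ds} → Pointwise _≈_ ms ds → flattenList ms ↭ flattenList ds
  flattenList-pointwise [] = ↭-refl
  flattenList-pointwise (e ∷ pw) = Perm.++⁺ (flatten-≈ e) (flattenList-pointwise pw)

∈-≈ : ∀ {t t' z} → t ≈ t' → z ∈ flatten t → z ∈ flatten t'
∈-≈ e = Perm.∈-resp-↭ (flatten-≈ e)

∈-≈⁻ : ∀ {t t' z} → t ≈ t' → z ∈ flatten t' → z ∈ flatten t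
∈-≈⁻ e = Perm.∈-resp-↭ (↭-sym (flatten-≈ e))

mutual
  RL-≈ : ∀ {t t'} → t ≈ t' → RecursivelyLabelled t → RecursivelyLabelled t'
  RL-≈ {t} {t'} e@(node _ cs↭ pw) (node iv rls) =
    node (interval-from-convex (flatten t') (∈-≈⁻ e) (∈-≈ e) iv) (RL-pointwise pw (Perm.All-resp-↭ cs↭ rls))

  RL-pointwise : ∀ {ms ds} → Pointwise _≈_ ms ds → All RecursivelyLabelled ms → All RecursivelyLabelled ds
  RL-pointwise [] [] = []
  RL-pointwise (e ∷ pw) (rl ∷ rls) = RL-≈ e rl ∷ RL-pointwise pw rls

module _ (P : List ℕ → List Tree → Set)
         (P-resp : ∀ {l l' cs ds} → l ↭ l' → flattenList cs ↭ flattenList ds → P l cs → P l' ds) where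
  mutual
    AllNodes-≈ : ∀ {t t'} → t ≈ t' → AllNodes P t → AllNodes P t'
    AllNodes-≈ (node l↭ cs↭ pw) (node p ps) =
      node (P-resp l↭ (↭-trans (flattenList-↭ cs↭) (flattenList-pointwise pw)) p)
           (AllNodes-pointwise pw (Perm.All-resp-↭ cs↭ ps))

    AllNodes-pointwise : ∀ {ms ds} → Pointwise _≈_ ms ds → All (AllNodes P) ms → All (AllNodes P) ds
    AllNodes-pointwise [] [] = []
    AllNodes-pointwise (e ∷ pw) (p ∷ ps) = AllNodes-≈ e p ∷ AllNodes-pointwise pw ps

NoEmptyNodes-≈ : ∀ {t t'} → t ≈ t' → NoEmptyNodes t → NoEmptyNodes t'
NoEmptyNodes-≈ = AllNodes-≈ NonEmptyLabels (λ {l} {l'} {cs} {ds} → nonEmpty-resp {l} {l'} {cs} {ds})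
  where
  nonEmpty-resp : ∀ {l l' cs ds} → l ↭ l' → flattenList cs ↭ flattenList ds →
                  NonEmptyLabels l cs → NonEmptyLabels l' ds
  nonEmpty-resp {[]} _ _ ne = ⊥-elim (ne refl)
  nonEmpty-resp {y ∷ l} l↭ _ _ refl = Perm.¬x∷xs↭[] l↭

RL-children : ∀ {l cs} → RecursivelyLabelled (node l cs) → All RecursivelyLabelled cs
RL-children (node _ rls) = rls

RL-interval : ∀ {l cs} → RecursivelyLabelled (node l cs) → IsInterval (flatten (node l cs))
RL-interval (node iv _) = iv

AllNodes-children : ∀ {P l cs} → AllNodes P (node l cs) → All (AllNodes P) cs
AllNodes-children (node _ ps) = ps

AllNodes-root : ∀ {P l cs} → AllNodes P (node l cs) → P l cs
AllNodes-root (node p _) = p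

-- In a tree whose labels are distinct this is automatic; the soundness proof
-- needs it to know that composition at x touches only the node carrying x.
SeparatedAt : List ℕ → List Tree → Set
SeparatedAt l cs = ∀ {y} → y ∈ l → y ∉ flattenList cs

Separated : Tree → Set
Separated = AllNodes SeparatedAt

Separated-≈ : ∀ {t t'} → t ≈ t' → Separated t → Separated t'
Separated-≈ = AllNodes-≈ SeparatedAt
  (λ l↭ cs↭ sep y∈ y∈' → sep (Perm.∈-resp-↭ (↭-sym l↭) y∈) (Perm.∈-resp-↭ (↭-sym cs↭) y∈'))

nonEmpty-map : ∀ (f : ℕ → ℕ) l → ¬ (l ≡ []) → ¬ (map f l ≡ [])
nonEmpty-map f [] ne _ = ne refl
nonEmpty-map f (_ ∷ _) ne ()

mutual
  NoEmptyNodes-map : ∀ f t → NoEmptyNodes t → NoEmptyNodes (mapLabels f t)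
  NoEmptyNodes-map f (node l cs) (node ne nes) = node (nonEmpty-map f l ne) (NoEmptyNodes-mapList f cs nes)

  NoEmptyNodes-mapList : ∀ f cs → All NoEmptyNodes cs → All NoEmptyNodes (mapLabelsList f cs)
  NoEmptyNodes-mapList f [] [] = []
  NoEmptyNodes-mapList f (c ∷ cs) (ne ∷ nes) = NoEmptyNodes-map f c ne ∷ NoEmptyNodes-mapList f cs nes

module _ (f : ℕ → ℕ) (f-injective : ∀ {a b} → f a ≡ f b → a ≡ b) where
  mutual
    Separated-map : ∀ t → Separated t → Separated (mapLabels f t)
    Separated-map (node l cs) (node sep seps) = node sep' (Separated-mapList cs seps)
      where
      sep' : SeparatedAt (map f l) (mapLabelsList f cs)
      sep' y∈ y∈' with ∈-map⁻ f y∈ | ∈-map⁻ f (subst (_ ∈_) (flattenList-mapLabelsList f cs) y∈')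
      ... | y₀ , y₀∈ , e₀ | y₁ , y₁∈ , e₁ =
        sep y₀∈ (subst (_∈ flattenList cs) (f-injective (≡-trans (sym e₁) e₀)) y₁∈)

    Separated-mapList : ∀ cs → All Separated cs → All Separated (mapLabelsList f cs)
    Separated-mapList [] [] = []
    Separated-mapList (c ∷ cs) (sep ∷ seps) = Separated-map c sep ∷ Separated-mapList cs seps

-- The interval condition is only needed for label sets satisfying
-- a property P that passes to subsets (e.g. "avoids a given range").
module _ (P : List ℕ → Set) (f : ℕ → ℕ)
         (P-⊆ : ∀ {L L'} → L' ⊆ L → P L → P L')
         (f-interval : ∀ {L} → P L → IsInterval L → IsInterval (map f L)) where
  mutual
    RL-map : ∀ t → P (flatten t) → RecursivelyLabelled t → RecursivelyLabelled (mapLabels f t)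
    RL-map (node l cs) p (node iv rls) =
      node (subst IsInterval (sym (flatten-mapLabels f (node l cs))) (f-interval p iv))
           (RL-mapList cs (P-⊆ (∈-++⁺ʳ l) p) rls)

    RL-mapList : ∀ cs → P (flattenList cs) → All RecursivelyLabelled cs → All RecursivelyLabelled (mapLabelsList f cs)
    RL-mapList [] p [] = []
    RL-mapList (c ∷ cs) p (rl ∷ rls) =
      RL-map c (P-⊆ ∈-++⁺ˡ p) rl ∷ RL-mapList cs (P-⊆ (∈-++⁺ʳ (flatten c)) p) rls

module _ (x s : ℕ) (ss : List ℕ) (csS : List Tree) where
  mutual
    go-fixed : ∀ t → x ∉ flatten t → go x (node (s ∷ ss) csS) t ≡ t
    go-fixed (node l cs) x∉ rewrite hasLabel-∉ x l (x∉ ∘ ∈-++⁺ˡ) =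
      cong (node l) (goList-fixed cs (x∉ ∘ ∈-++⁺ʳ l))

    goList-fixed : ∀ cs → x ∉ flattenList cs → goList x (node (s ∷ ss) csS) cs ≡ cs
    goList-fixed [] x∉ = refl
    goList-fixed (node l cs ∷ ds) x∉ =
      cong₂ _∷_ (go-fixed (node l cs) (x∉ ∘ ∈-++⁺ˡ)) (goList-fixed ds (x∉ ∘ ∈-++⁺ʳ (flatten (node l cs))))

  go-leaf : ∀ l cs → x ∉ l → x ∉ flattenList cs →
            go x (node (s ∷ ss) csS) (node l (leaf (x ∷ []) ∷ cs)) ≡ node l (node (s ∷ ss) csS ∷ cs)
  go-leaf l cs x∉l x∉cs rewrite hasLabel-∉ x l x∉l | ≡ᵇ-refl x =
    cong (λ ds → node l (node (s ∷ ss) csS ∷ ds)) (goList-fixed cs x∉cs)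

-- Composing at x with a tree of weight k'+1 relabels the first factor by
-- `shift`, which opens a gap of k' places above x; the block x, …, x+k' is then
-- filled by the labels of the second factor.  `unshift` collapses this block
-- back to x and is a monotone left inverse of `shift`: a label z of the
-- composite comes from the label `unshift z` of the first factor.
module Shift (x k' : ℕ) where
  shift : ℕ → ℕ
  shift = shiftAbove x (suc k')

  shift-≤ : ∀ {y} → y ≤ x → shift y ≡ y
  shift-≤ {y} y≤x with x <ᵇ y in eq
  ... | true = ⊥-elim (<⇒≱ (<ᵇ⇒< x y (subst T (sym eq) tt)) y≤x)
  ... | false = refl

  shift-> : ∀ {y} → x < y → shift y ≡ y + k'
  shift-> {y} x<y with x <ᵇ y in eq
  ... | true = cong (_∸ 1) (+-suc y k')
  ... | false = ⊥-elim (subst T eq (<⇒<ᵇ x<y))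

  self-≤-shift : ∀ y → y ≤ shift y
  self-≤-shift y with ≤-<-connex y x
  ... | inj₁ y≤x = ≤-reflexive (sym (shift-≤ y≤x))
  ... | inj₂ x<y = subst (y ≤_) (sym (shift-> x<y)) (m≤m+n y k')

  shift-≤-self+ : ∀ y → shift y ≤ y + k'
  shift-≤-self+ y with ≤-<-connex y x
  ... | inj₁ y≤x = subst (_≤ y + k') (sym (shift-≤ y≤x)) (m≤m+n y k')
  ... | inj₂ x<y = ≤-reflexive (shift-> x<y)

  shift-mono : ∀ {y y'} → y ≤ y' → shift y ≤ shift y'
  shift-mono {y} {y'} y≤y' with ≤-<-connex y x
  ... | inj₁ y≤x = subst (_≤ shift y') (sym (shift-≤ y≤x)) (≤-trans y≤y' (self-≤-shift y'))
  ... | inj₂ x<y = subst₂ _≤_ (sym (shift-> x<y)) (sym (shift-> (<-≤-trans x<y y≤y'))) (+-monoˡ-≤ k' y≤y')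

  -- unshift z = z for z ≤ x, = x on the block x, …, x+k', and = z - k' above it.
  unshift : ℕ → ℕ
  unshift z = (z ⊓ x) ⊔ (z ∸ k')

  unshift-≤ : ∀ {z} → z ≤ x → unshift z ≡ z
  unshift-≤ {z} z≤x = ≡-trans (cong (_⊔ (z ∸ k')) (m≤n⇒m⊓n≡m z≤x)) (m≥n⇒m⊔n≡m (m∸n≤m z k'))

  unshift-block : ∀ {z} → x ≤ z → z ≤ x + k' → unshift z ≡ x
  unshift-block {z} x≤z z≤ = ≡-trans (cong (_⊔ (z ∸ k')) (m≥n⇒m⊓n≡n x≤z))
    (m≥n⇒m⊔n≡m (m≤n+o⇒m∸n≤o z k' (≤-trans z≤ (≤-reflexive (+-comm x k')))))

  unshift-above : ∀ {z} → x + k' ≤ z → unshift z ≡ z ∸ k'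
  unshift-above {z} x+k'≤z = ≡-trans (cong (_⊔ (z ∸ k')) (m≥n⇒m⊓n≡n (≤-trans (m≤m+n x k') x+k'≤z)))
    (m≤n⇒m⊔n≡n (m+n≤o⇒m≤o∸n x x+k'≤z))

  unshift-mono : ∀ {z w} → z ≤ w → unshift z ≤ unshift w
  unshift-mono z≤w = ⊔-mono-≤ (⊓-monoˡ-≤ x z≤w) (∸-monoˡ-≤ k' z≤w)

  unshift-≤-self : ∀ z → unshift z ≤ z
  unshift-≤-self z = ⊔-lub (m⊓n≤m z x) (m∸n≤m z k')

  self-≤-unshift+ : ∀ z → z ≤ unshift z + k'
  self-≤-unshift+ z = ≤-trans (m≤n+m∸n z k')
    (≤-trans (+-monoʳ-≤ k' (m≤n⊔m (z ⊓ x) (z ∸ k'))) (≤-reflexive (+-comm k' (unshift z))))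

  unshift-shift : ∀ y → unshift (shift y) ≡ y
  unshift-shift y with ≤-<-connex y x
  ... | inj₁ y≤x = ≡-trans (cong unshift (shift-≤ y≤x)) (unshift-≤ y≤x)
  ... | inj₂ x<y = begin
    unshift (shift y) ≡⟨ cong unshift (shift-> x<y) ⟩
    unshift (y + k')  ≡⟨ unshift-above (+-monoˡ-≤ k' (<⇒≤ x<y)) ⟩
    y + k' ∸ k'       ≡⟨ m+n∸n≡m y k' ⟩
    y                 ∎
    where open ≡-Reasoning

  unshift≡x⇒block : ∀ {z} → unshift z ≡ x → x ≤ z × z ≤ x + k'
  unshift≡x⇒block {z} eq =
    subst (_≤ z) eq (unshift-≤-self z) , subst (λ u → z ≤ u + k') eq (self-≤-unshift+ z)

  Outside : ℕ → Set
  Outside z = z ≤ x ⊎ x + k' < z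

  shift-unshift-outside : ∀ {z} → Outside z → shift (unshift z) ≡ z
  shift-unshift-outside (inj₁ z≤x) = ≡-trans (cong shift (unshift-≤ z≤x)) (shift-≤ z≤x)
  shift-unshift-outside {z} (inj₂ x+k'<z) = begin
    shift (unshift z) ≡⟨ cong shift (unshift-above (<⇒≤ x+k'<z)) ⟩
    shift (z ∸ k')    ≡⟨ shift-> (m+n≤o⇒m≤o∸n (suc x) x+k'<z) ⟩
    z ∸ k' + k'       ≡⟨ m∸n+n≡m (≤-trans (m≤n+m k' x) (<⇒≤ x+k'<z)) ⟩
    z                 ∎
    where open ≡-Reasoning

  outside-or-block : ∀ z → Outside z ⊎ (x ≤ z × z ≤ x + k')
  outside-or-block z with z ≤? x | z ≤? x + k'
  ... | yes z≤x | _ = inj₁ (inj₁ z≤x)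
  ... | no z≰x | yes z≤ = inj₂ (<⇒≤ (≰⇒> z≰x) , z≤)
  ... | no _ | no z≰ = inj₁ (inj₂ (≰⇒> z≰))

  shift-unshift : ∀ z → unshift z ≢ x → shift (unshift z) ≡ z
  shift-unshift z u≢x with outside-or-block z
  ... | inj₁ out = shift-unshift-outside out
  ... | inj₂ (x≤z , z≤) = ⊥-elim (u≢x (unshift-block x≤z z≤))

  unshift-injective-outside : ∀ {z w} → Outside z → Outside w → unshift z ≡ unshift w → z ≡ w
  unshift-injective-outside {z} {w} out-z out-w eq =
    ≡-trans (sym (shift-unshift-outside out-z)) (≡-trans (cong shift eq) (shift-unshift-outside out-w))

  unshift-interval : ∀ L → (∀ {z} → z ∈ L → Outside z) → IsInterval L → IsInterval (map unshift L)
  unshift-interval L outside iv i j m i∈ j∈ i≤m m≤j with ∈-map⁻ unshift i∈ | ∈-map⁻ unshift j∈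
  ... | y₁ , y₁∈ , refl | y₂ , y₂∈ , refl =
    subst (_∈ map unshift L) (unshift-shift m) (∈-map⁺ unshift (iv y₁ y₂ (shift m) y₁∈ y₂∈ y₁≤ ≤y₂))
    where
    y₁≤ : y₁ ≤ shift m
    y₁≤ = subst (_≤ shift m) (shift-unshift-outside (outside y₁∈)) (shift-mono i≤m)
    ≤y₂ : shift m ≤ y₂
    ≤y₂ = subst (shift m ≤_) (shift-unshift-outside (outside y₂∈)) (shift-mono m≤j)

  -- The key fact about intervals: if the labels L of a subtree of the first
  -- factor form an interval, so do the labels of the corresponding subtree
  -- of the composite, namely the z with unshift z ∈ L.
  unshift-preimage-convex : ∀ L → IsInterval L → Convex (λ z → unshift z ∈ L)
  unshift-preimage-convex L iv i j m i∈ j∈ i≤m m≤j =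
    iv (unshift i) (unshift j) (unshift m) i∈ j∈ (unshift-mono i≤m) (unshift-mono m≤j)

-- Read forwards this gives the labels
-- of a composite, read backwards those of a first factor.
module _ (x k' n : ℕ) (1≤x : 1 ≤ x) (x≤n : x ≤ n) where
  open Shift x k'

  unshift-bounds : ∀ {z} → 1 ≤ z → z ≤ n + k' → 1 ≤ unshift z × unshift z ≤ n
  unshift-bounds {z} 1≤z z≤ =
    subst (_≤ unshift z) (unshift-≤ 1≤x) (unshift-mono 1≤z) ,
    subst (unshift z ≤_) (≡-trans (unshift-above (+-monoˡ-≤ k' x≤n)) (m+n∸n≡m n k')) (unshift-mono z≤)

  Spans-unshift : ∀ {F R} → Spans F 1 n →
                  (∀ {z} → z ∈ R → unshift z ∈ F) → (∀ {z} → unshift z ∈ F → z ∈ R) →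
                  Spans R 1 (n + k')
  Spans-unshift {F} {R} (to , from) R⇒F F⇒R = to' , from'
    where
    to' : ∀ {z} → z ∈ R → 1 ≤ z × z ≤ n + k'
    to' {z} z∈ = let (1≤u , u≤n) = to (R⇒F z∈) in
      ≤-trans 1≤u (unshift-≤-self z) , ≤-trans (self-≤-unshift+ z) (+-monoˡ-≤ k' u≤n)
    from' : ∀ {z} → 1 ≤ z → z ≤ n + k' → z ∈ R
    from' 1≤z z≤ = let (1≤u , u≤n) = unshift-bounds 1≤z z≤ in F⇒R (from 1≤u u≤n)

  Spans-unshift⁻ : ∀ {F R} → Spans R 1 (n + k') →
                   (∀ {z} → z ∈ R → unshift z ∈ F) → (∀ {z} → unshift z ∈ F → z ∈ R) →
                   Spans F 1 n
  Spans-unshift⁻ {F} {R} (to , from) R⇒F F⇒R = to' , from'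
    where
    to' : ∀ {u} → u ∈ F → 1 ≤ u × u ≤ n
    to' {u} u∈ = let (1≤ , ≤n+k') = to (F⇒R (subst (_∈ F) (sym (unshift-shift u)) u∈)) in
      subst (λ v → 1 ≤ v × v ≤ n) (unshift-shift u) (unshift-bounds 1≤ ≤n+k')
    from' : ∀ {u} → 1 ≤ u → u ≤ n → u ∈ F
    from' {u} 1≤u u≤n = subst (_∈ F) (unshift-shift u)
      (R⇒F (from (≤-trans 1≤u (self-≤-shift u)) (≤-trans (shift-≤-self+ u) (+-monoˡ-≤ k' u≤n))))

-- Rule (W) applies at the node
-- carrying x; every other node is merely relabelled by `shift`.
module Substitution (x k' s : ℕ) (ss : List ℕ) (csS : List Tree)
  (RL-S : RecursivelyLabelled (node (s ∷ ss) csS))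
  (NE-S : NoEmptyNodes (node (s ∷ ss) csS))
  (sep-S : Separated (node (s ∷ ss) csS))
  (span-S : Spans (flatten (node (s ∷ ss) csS)) x (x + k')) where
  open Shift x k'

  S : Tree
  S = node (s ∷ ss) csS

  -- the part of T₁ ∘ₓ S coming from a subtree t of the first factor T₁
  substitute : Tree → Tree
  substitute t = go x S (mapLabels shift t)

  substituteList : List Tree → List Tree
  substituteList cs = goList x S (mapLabelsList shift cs)

  record Substituted (F : List ℕ) (r : Tree) : Set where
    constructor substituted
    field
      recursive : RecursivelyLabelled r
      noEmpty   : NoEmptyNodes r
      separated : Separated r
      labels⁺   : ∀ {z} → z ∈ flatten r → unshift z ∈ F
      labels⁻   : ∀ {z} → unshift z ∈ F → z ∈ flatten r

  record SubstitutedList (F : List ℕ) (rs : List Tree) : Set where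
    constructor substitutedList
    field
      recursive : All RecursivelyLabelled rs
      noEmpty   : All NoEmptyNodes rs
      separated : All Separated rs
      labels⁺   : ∀ {z} → z ∈ flattenList rs → unshift z ∈ F
      labels⁻   : ∀ {z} → unshift z ∈ F → z ∈ flattenList rs

  ∈S⇒unshift≡x : ∀ {z} → z ∈ flatten S → unshift z ≡ x
  ∈S⇒unshift≡x z∈ = let (x≤z , z≤) = proj₁ span-S z∈ in unshift-block x≤z z≤

  unshift≡x⇒∈S : ∀ {z} → unshift z ≡ x → z ∈ flatten S
  unshift≡x⇒∈S eq = let (x≤z , z≤) = unshift≡x⇒block eq in proj₂ span-S x≤z z≤

  unshift-x : unshift x ≡ x
  unshift-x = unshift-≤ ≤-refl

  unshift-∈-map : ∀ {z l} → z ∈ map shift l → unshift z ∈ l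
  unshift-∈-map {l = l} z∈ with ∈-map⁻ shift z∈
  ... | y , y∈ , refl = subst (_∈ l) (sym (unshift-shift y)) y∈

  ∈-map-shift : ∀ {z l} → unshift z ∈ l → unshift z ≢ x → z ∈ map shift l
  ∈-map-shift {z} {l} u∈ u≢x = subst (_∈ map shift l) (shift-unshift z u≢x) (∈-map⁺ shift u∈)

  x∉map-shift : ∀ {l} → x ∉ l → x ∉ map shift l
  x∉map-shift {l} x∉l x∈ = x∉l (subst (_∈ l) unshift-x (unshift-∈-map x∈))

  substituteList-fixed : ∀ cs → x ∉ flattenList cs → substituteList cs ≡ mapLabelsList shift cs
  substituteList-fixed cs x∉ = goList-fixed x s ss csS (mapLabelsList shift cs)
    (x∉map-shift x∉ ∘ subst (x ∈_) (flattenList-mapLabelsList shift cs))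

  relabel-node : ∀ l cs → RecursivelyLabelled (node l cs) → NonEmptyLabels l cs → SeparatedAt l cs → x ∉ l →
                 SubstitutedList (flattenList cs) (substituteList cs) →
                 Substituted (flatten (node l cs)) (node (map shift l) (substituteList cs))
  relabel-node l cs (node iv _) ne sep x∉l (substitutedList rls nes seps below⁺ below⁻) =
    substituted (node (interval-from-convex _ labels⁺ labels⁻ (unshift-preimage-convex _ iv)) rls)
                (node (nonEmpty-map shift l ne) nes) (node sep' seps) labels⁺ labels⁻
    where
    F : List ℕ
    F = flattenList cs
    labels⁺ : ∀ {z} → z ∈ map shift l ++ flattenList (substituteList cs) → unshift z ∈ l ++ F
    labels⁺ z∈ with ∈-++⁻ (map shift l) z∈
    ... | inj₁ z∈l = ∈-++⁺ˡ (unshift-∈-map z∈l)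
    ... | inj₂ z∈cs = ∈-++⁺ʳ l (below⁺ z∈cs)
    labels⁻ : ∀ {z} → unshift z ∈ l ++ F → z ∈ map shift l ++ flattenList (substituteList cs)
    labels⁻ u∈ with ∈-++⁻ l u∈
    ... | inj₁ u∈l = ∈-++⁺ˡ (∈-map-shift u∈l (λ u≡x → x∉l (subst (_∈ l) u≡x u∈l)))
    ... | inj₂ u∈F = ∈-++⁺ʳ (map shift l) (below⁻ u∈F)
    sep' : SeparatedAt (map shift l) (substituteList cs)
    sep' y∈ y∈' = sep (unshift-∈-map y∈) (below⁺ y∈')

  W-root⁻ : ∀ l {z} → z ∈ removeLabel x (map shift l) ++ s ∷ ss →
            (unshift z ∈ l × unshift z ≢ x) ⊎ z ∈ s ∷ ss
  W-root⁻ l z∈ with ∈-++⁻ (removeLabel x (map shift l)) z∈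
  ... | inj₂ z∈S = inj₂ z∈S
  ... | inj₁ z∈R₀ with removeLabel⁻ x (map shift l) z∈R₀
  ...   | z∈l , z≢x = inj₁ (unshift-∈-map z∈l , λ u≡x → z≢x (shifted-unshift≡x z∈l u≡x))
    where
    shifted-unshift≡x : ∀ {z} → z ∈ map shift l → unshift z ≡ x → z ≡ x
    shifted-unshift≡x z∈ u≡x with ∈-map⁻ shift z∈
    ... | y , _ , refl = ≡-trans (cong shift (≡-trans (sym (unshift-shift y)) u≡x)) (shift-≤ ≤-refl)

  substitute-node : ∀ l cs → RecursivelyLabelled (node l cs) → SeparatedAt l cs → x ∈ l →
                    SubstitutedList (flattenList cs) (substituteList cs) →
                    Substituted (flatten (node l cs))
                      (node (removeLabel x (map shift l) ++ s ∷ ss) (substituteList cs ++ csS))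
  substitute-node l cs (node iv _) sep x∈l (substitutedList rls nes seps below⁺ below⁻) =
    substituted (node (interval-from-convex _ labels⁺ labels⁻ (unshift-preimage-convex _ iv))
                      (All-++⁺ rls (RL-children RL-S)))
                (node (nonEmpty-++ (removeLabel x (map shift l))) (All-++⁺ nes (AllNodes-children NE-S)))
                (node sep' (All-++⁺ seps (AllNodes-children sep-S))) labels⁺ labels⁻
    where
    F : List ℕ
    F = flattenList cs
    R₀ : List ℕ
    R₀ = removeLabel x (map shift l)
    nonEmpty-++ : ∀ (A : List ℕ) → ¬ (A ++ s ∷ ss ≡ [])
    nonEmpty-++ [] ()
    nonEmpty-++ (_ ∷ _) ()
    labels⁺ : ∀ {z} → z ∈ (R₀ ++ s ∷ ss) ++ flattenList (substituteList cs ++ csS) → unshift z ∈ l ++ F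
    labels⁺ z∈ with ∈-++⁻ (R₀ ++ s ∷ ss) z∈
    ... | inj₂ z∈below with ∈-flattenList-++⁻ (substituteList cs) z∈below
    ...   | inj₁ z∈cs = ∈-++⁺ʳ l (below⁺ z∈cs)
    ...   | inj₂ z∈csS = ∈-++⁺ˡ (subst (_∈ l) (sym (∈S⇒unshift≡x (∈-++⁺ʳ (s ∷ ss) z∈csS))) x∈l)
    labels⁺ z∈ | inj₁ z∈root with W-root⁻ l z∈root
    ...   | inj₁ (u∈l , _) = ∈-++⁺ˡ u∈l
    ...   | inj₂ z∈S = ∈-++⁺ˡ (subst (_∈ l) (sym (∈S⇒unshift≡x (∈-++⁺ˡ z∈S))) x∈l)
    labels⁻ : ∀ {z} → unshift z ∈ l ++ F → z ∈ (R₀ ++ s ∷ ss) ++ flattenList (substituteList cs ++ csS)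
    labels⁻ {z} u∈ with ∈-++⁻ l u∈
    ... | inj₂ u∈F = ∈-++⁺ʳ (R₀ ++ s ∷ ss) (∈-flattenList-++⁺ (substituteList cs) (inj₁ (below⁻ u∈F)))
    ... | inj₁ u∈l with unshift z ≟ x
    ...   | no u≢x = ∈-++⁺ˡ (∈-++⁺ˡ (removeLabel⁺ x (map shift l) (∈-map-shift u∈l u≢x)
                                       (λ z≡x → u≢x (≡-trans (cong unshift z≡x) unshift-x))))
    ...   | yes u≡x with ∈-++⁻ (s ∷ ss) (unshift≡x⇒∈S u≡x)
    ...     | inj₁ z∈rootS = ∈-++⁺ˡ (∈-++⁺ʳ R₀ z∈rootS)
    ...     | inj₂ z∈csS = ∈-++⁺ʳ (R₀ ++ s ∷ ss) (∈-flattenList-++⁺ (substituteList cs) (inj₂ z∈csS))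
    sep' : SeparatedAt (R₀ ++ s ∷ ss) (substituteList cs ++ csS)
    sep' y∈ y∈' with W-root⁻ l y∈ | ∈-flattenList-++⁻ (substituteList cs) y∈'
    ... | inj₁ (u∈l , _) | inj₁ y∈cs = sep u∈l (below⁺ y∈cs)
    ... | inj₁ (_ , u≢x) | inj₂ y∈csS = u≢x (∈S⇒unshift≡x (∈-++⁺ʳ (s ∷ ss) y∈csS))
    ... | inj₂ y∈S | inj₁ y∈cs = sep x∈l (subst (_∈ F) (∈S⇒unshift≡x (∈-++⁺ˡ y∈S)) (below⁺ y∈cs))
    ... | inj₂ y∈S | inj₂ y∈csS = AllNodes-root sep-S y∈S y∈csS

  mutual
    substitute-correct : ∀ t → RecursivelyLabelled t → NoEmptyNodes t → Separated t →
                         Substituted (flatten t) (substitute t)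
    substitute-correct (node l cs) rl (node ne nes) (node sep seps) with hasLabel x (map shift l) in eq
    ... | false = relabel-node l cs rl ne sep x∉l (substituteList-correct cs (RL-children rl) nes seps)
      where
      x∉l : x ∉ l
      x∉l x∈l = hasLabel-false x (map shift l) eq (subst (_∈ map shift l) (shift-≤ ≤-refl) (∈-map⁺ shift x∈l))
    ... | true = subst (λ ds → Substituted (flatten (node l cs)) (node (removeLabel x (map shift l) ++ s ∷ ss) (ds ++ csS)))
                   (substituteList-fixed cs (sep x∈l))
                   (substitute-node l cs rl sep x∈l (substituteList-correct cs (RL-children rl) nes seps))
      where
      x∈l : x ∈ l
      x∈l = subst (_∈ l) unshift-x (unshift-∈-map (hasLabel-true x (map shift l) eq))

    substituteList-correct : ∀ cs → All RecursivelyLabelled cs → All NoEmptyNodes cs → All Separated cs →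
                             SubstitutedList (flattenList cs) (substituteList cs)
    substituteList-correct [] [] [] [] = substitutedList [] [] [] (λ ()) (λ ())
    substituteList-correct (node l cs ∷ ds) (rl ∷ rls) (ne ∷ nes) (sep ∷ seps)
      with substitute-correct (node l cs) rl ne sep | substituteList-correct ds rls nes seps
    ... | substituted rl' ne' sep' head⁺ head⁻ | substitutedList rls' nes' seps' tail⁺ tail⁻ =
      substitutedList (rl' ∷ rls') (ne' ∷ nes') (sep' ∷ seps') labels⁺ labels⁻
      where
      A : List ℕ
      A = flatten (node l cs)
      r : Tree
      r = substitute (node l cs)
      labels⁺ : ∀ {z} → z ∈ flatten r ++ flattenList (substituteList ds) → unshift z ∈ A ++ flattenList ds
      labels⁺ z∈ = [ ∈-++⁺ˡ ∘ head⁺ , ∈-++⁺ʳ A ∘ tail⁺ ] (∈-++⁻ (flatten r) z∈)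
      labels⁻ : ∀ {z} → unshift z ∈ A ++ flattenList ds → z ∈ flatten r ++ flattenList (substituteList ds)
      labels⁻ u∈ = [ ∈-++⁺ˡ ∘ head⁻ , ∈-++⁺ʳ (flatten r) ∘ tail⁻ ] (∈-++⁻ A u∈)

record Admissible (n : ℕ) (T : Tree) : Set where
  constructor admissible
  field
    recursive : RecursivelyLabelled T
    noEmpty   : NoEmptyNodes T
    separated : Separated T
    spans     : Spans (flatten T) 1 n

admissible-≈ : ∀ {n T T'} → T ≈ T' → Admissible n T → Admissible n T'
admissible-≈ e (admissible rl ne sep sp) =
  admissible (RL-≈ e rl) (NoEmptyNodes-≈ e ne) (Separated-≈ e sep) (Spans-↭ (flatten-≈ e) sp)

-- A composite of admissible trees is admissible.  (An admissible second factor
-- has weight k = k'+1 > 0 and a labelled root.)  It is first translated by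
-- x - 1, so that its labels become x, …, x+k'.
compose-admissible : ∀ {n k x T₁ T₂} → Admissible n T₁ → Admissible k T₂ → 1 ≤ x → x ≤ n →
                     Admissible (n + k ∸ 1) (compose x k T₁ T₂)
compose-admissible {T₂ = node [] _} _ (admissible _ (node ne _) _ _) _ _ = ⊥-elim (ne refl)
compose-admissible {k = zero} {T₂ = node (_ ∷ _) _} _ (admissible _ _ _ (to , _)) _ _ with to (here refl)
... | s≤s _ , ()
compose-admissible {n} {suc k'} {suc x'} {node l₁ cs₁} {node (a ∷ as) cs₂}
                   (admissible rl₁ ne₁ sep₁ sp₁) (admissible rl₂ ne₂ sep₂ sp₂) 1≤x x≤n =
  subst (λ m → Admissible m (substitute T₁)) (sym (cong (_∸ 1) (+-suc n k')))
    (admissible recursive noEmpty separated (Spans-unshift (suc x') k' n 1≤x x≤n sp₁ labels⁺ labels⁻))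
  where
  T₁ T₂ : Tree
  T₁ = node l₁ cs₁
  T₂ = node (a ∷ as) cs₂
  translate : ℕ → ℕ
  translate y = y + x'
  span-S : Spans (flatten (mapLabels translate T₂)) (suc x') (suc x' + k')
  span-S = subst₂ (λ L hi → Spans L (suc x') hi) (sym (flatten-mapLabels translate T₂)) (cong suc (+-comm k' x'))
             (Spans-translate x' sp₂)
  open Substitution (suc x') k' (a + x') (map translate as) (mapLabelsList translate cs₂)
         (RL-map (λ _ → ⊤) translate (λ _ _ → tt) (λ _ → interval-translate x' _) T₂ tt rl₂)
         (NoEmptyNodes-map translate T₂ ne₂)
         (Separated-map translate (λ {u} {v} → +-cancelʳ-≡ x' u v) T₂ sep₂)
         span-S
  open Substituted (substitute-correct T₁ rl₁ ne₁ sep₁)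

BWT⇒admissible : ∀ {n T} → BWT n T → Admissible n T
BWT⇒admissible unit =
  admissible (node (singleton-interval 1) []) (node (λ ()) []) (node (λ _ ()) []) (Spans-oneTo 1)
BWT⇒admissible gen₁ =
  admissible (node (span-interval (Spans-oneTo 2)) []) (node (λ ()) []) (node (λ _ ()) []) (Spans-oneTo 2)
BWT⇒admissible gen₂ =
  admissible (node (span-interval (Spans-oneTo 2)) (node (singleton-interval 2) [] ∷ []))
             (node (λ ()) (node (λ ()) [] ∷ [])) (node (λ { (here refl) (here ()) }) (node (λ _ ()) [] ∷ []))
             (Spans-oneTo 2)
BWT⇒admissible gen₃ =
  admissible (node (span-interval spans-21) (node (singleton-interval 1) [] ∷ []))
             (node (λ ()) (node (λ ()) [] ∷ [])) (node (λ { (here refl) (here ()) }) (node (λ _ ()) [] ∷ []))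
             spans-21
  where
  spans-21 : Spans (2 ∷ 1 ∷ []) 1 2
  spans-21 = Spans-↭ (swap 1 2 refl) (Spans-oneTo 2)
BWT⇒admissible (comp b₁ b₂ 1≤x x≤n) = compose-admissible (BWT⇒admissible b₁) (BWT⇒admissible b₂) 1≤x x≤n
BWT⇒admissible (iso b e) = admissible-≈ e (BWT⇒admissible b)

uniqueSameMembers⇒↭ : ∀ {xs ys : List ℕ} → Unique xs → Unique ys →
                      (∀ {z} → z ∈ xs → z ∈ ys) → (∀ {z} → z ∈ ys → z ∈ xs) → xs ↭ ys
uniqueSameMembers⇒↭ ux uy to from = ∼bag⇒↭ (unique∧set⇒bag ux uy (mk⇔ to from))

Unique-resp-↭ : ∀ {xs ys : List ℕ} → xs ↭ ys → Unique xs → Unique ys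
Unique-resp-↭ xs↭ys = PermSetoid.Unique-resp-↭ (setoid ℕ) (↭⇒↭ₛ xs↭ys)

Unique-++ˡ : ∀ (A : List ℕ) {B} → Unique (A ++ B) → Unique A
Unique-++ˡ [] _ = []
Unique-++ˡ (a ∷ A) (a∉ ∷ u) = All.tabulate (λ z∈A → All.lookup a∉ (∈-++⁺ˡ z∈A)) ∷ Unique-++ˡ A u

Unique-++ʳ : ∀ (A : List ℕ) {B} → Unique (A ++ B) → Unique B
Unique-++ʳ [] u = u
Unique-++ʳ (a ∷ A) (_ ∷ u) = Unique-++ʳ A u

Unique-++-disjoint : ∀ (A : List ℕ) {B z} → Unique (A ++ B) → z ∈ A → z ∈ B → ⊥
Unique-++-disjoint (a ∷ A) (a∉ ∷ _) (here refl) z∈B = All.lookup a∉ (∈-++⁺ʳ A z∈B) refl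
Unique-++-disjoint (a ∷ A) (_ ∷ u) (there z∈A) z∈B = Unique-++-disjoint A u z∈A z∈B

Unique-map : ∀ (f : ℕ → ℕ) {xs} → (∀ {a b} → a ∈ xs → b ∈ xs → f a ≡ f b → a ≡ b) →
             Unique xs → Unique (map f xs)
Unique-map f {[]} _ [] = []
Unique-map f {y ∷ xs} injective (y∉ ∷ u) =
  All.tabulate fy∉ ∷ Unique-map f (λ a∈ b∈ → injective (there a∈) (there b∈)) u
  where
  fy∉ : ∀ {z} → z ∈ map f xs → f y ≢ z
  fy∉ z∈ fy≡z with ∈-map⁻ f z∈
  ... | w , w∈ , refl = All.lookup y∉ w∈ (injective (here refl) (there w∈) fy≡z)

Spans-remove-max : ∀ {m L} → Unique (suc m ∷ L) → Spans (suc m ∷ L) 1 (suc m) → Spans L 1 m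
Spans-remove-max {m} {L} (top∉ ∷ _) (to , from) = to' , from'
  where
  to' : ∀ {z} → z ∈ L → 1 ≤ z × z ≤ m
  to' z∈ = let (1≤z , z≤) = to (there z∈) in
    1≤z , ≤-pred (≤∧≢⇒< z≤ (λ z≡ → All.lookup top∉ z∈ (sym z≡)))
  from' : ∀ {z} → 1 ≤ z → z ≤ m → z ∈ L
  from' 1≤z z≤m with from 1≤z (m≤n⇒m≤1+n z≤m)
  ... | here refl = ⊥-elim (<-irrefl refl (s≤s z≤m))
  ... | there z∈ = z∈

Spans-remove-min : ∀ {m L} → Unique (1 ∷ L) → Spans (1 ∷ L) 1 (suc m) → Spans L 2 (suc m)
Spans-remove-min {m} {L} (one∉ ∷ _) (to , from) = to' , from'
  where
  to' : ∀ {z} → z ∈ L → 2 ≤ z × z ≤ suc m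
  to' z∈ = let (1≤z , z≤) = to (there z∈) in
    ≤∧≢⇒< 1≤z (λ 1≡z → All.lookup one∉ z∈ 1≡z) , z≤
  from' : ∀ {z} → 2 ≤ z → z ≤ suc m → z ∈ L
  from' 2≤z z≤ with from (≤-trans (n≤1+n 1) 2≤z) z≤
  ... | here refl = ⊥-elim (<-irrefl refl 2≤z)
  ... | there z∈ = z∈

record RLTree (n : ℕ) (T : Tree) : Set where
  constructor rlTree
  field
    distinct  : Unique (flatten T)
    spans     : Spans (flatten T) 1 n
    recursive : RecursivelyLabelled T
    noEmpty   : NoEmptyNodes T

RLTree-≈ : ∀ {n T T'} → T ≈ T' → RLTree n T → RLTree n T'
RLTree-≈ e (rlTree u sp rl ne) =
  rlTree (Unique-resp-↭ (flatten-≈ e) u) (Spans-↭ (flatten-≈ e) sp) (RL-≈ e rl) (NoEmptyNodes-≈ e ne)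

wellFormed⇒RLTree : ∀ {n T} → WellFormed n T → RecursivelyLabelled T → NoEmptyNodes T → RLTree n T
wellFormed⇒RLTree {n} (T↭ , _) rl ne =
  rlTree (Unique-resp-↭ (↭-sym T↭) (Unique.map⁺ suc-injective (Unique.upTo⁺ n)))
         (Spans-↭ (↭-sym T↭) (Spans-oneTo n)) rl ne

RLTree-weight0 : ∀ {T} → RLTree 0 T → ⊥
RLTree-weight0 {node [] _} (rlTree _ _ _ (node ne _)) = ne refl
RLTree-weight0 {node (_ ∷ _) _} (rlTree _ (to , _) _ _) with to (here refl)
... | s≤s _ , ()

interval-translate-down : ∀ c L → (∀ {z} → z ∈ L → c ≤ z) → IsInterval L → IsInterval (map (λ y → y ∸ c) L)
interval-translate-down c L c≤ iv i j m i∈ j∈ i≤m m≤j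
  with ∈-map⁻ (λ y → y ∸ c) i∈ | ∈-map⁻ (λ y → y ∸ c) j∈
... | y₁ , y₁∈ , refl | y₂ , y₂∈ , refl =
  subst (_∈ map (λ y → y ∸ c) L) (m+n∸n≡m m c)
    (∈-map⁺ (λ y → y ∸ c) (iv y₁ y₂ (m + c) y₁∈ y₂∈ y₁≤ ≤y₂))
  where
  y₁≤ : y₁ ≤ m + c
  y₁≤ = subst (_≤ m + c) (m∸n+n≡m (c≤ y₁∈)) (+-monoˡ-≤ c i≤m)
  ≤y₂ : m + c ≤ y₂
  ≤y₂ = subst (m + c ≤_) (m∸n+n≡m (c≤ y₂∈)) (+-monoˡ-≤ c m≤j)

RLTree-translate-down : ∀ c m l cs → Unique (flatten (node l cs)) → Spans (flatten (node l cs)) (suc c) (c + m) →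
                        All RecursivelyLabelled cs → NoEmptyNodes (node l cs) →
                        RLTree m (mapLabels (λ y → y ∸ c) (node l cs))
RLTree-translate-down c m l cs u (to , from) rls ne =
  rlTree (subst Unique (sym flatten≡) (Unique-map down down-injective u)) spans'
         (node (span-interval spans') (RL-mapList AboveC down (λ ⊆ c≤ → c≤ ∘ ⊆) (interval-translate-down c _) cs
                                         (c≤ ∘ ∈-++⁺ʳ l) rls))
         (NoEmptyNodes-map down (node l cs) ne)
  where
  down : ℕ → ℕ
  down y = y ∸ c
  U : Tree
  U = node l cs
  flatten≡ : flatten (mapLabels down U) ≡ map down (flatten U)
  flatten≡ = flatten-mapLabels down U
  AboveC : List ℕ → Set
  AboveC L = ∀ {z} → z ∈ L → c ≤ z
  c≤ : AboveC (flatten U)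
  c≤ z∈ = ≤-trans (n≤1+n c) (proj₁ (to z∈))
  down-injective : ∀ {a b} → a ∈ flatten U → b ∈ flatten U → down a ≡ down b → a ≡ b
  down-injective a∈ b∈ = ∸-cancelʳ-≡ (c≤ a∈) (c≤ b∈)
  spans' : Spans (flatten (mapLabels down U)) 1 m
  spans' = to' , from'
    where
    to' : ∀ {z} → z ∈ flatten (mapLabels down U) → 1 ≤ z × z ≤ m
    to' {z} z∈ with ∈-map⁻ down (subst (z ∈_) flatten≡ z∈)
    ... | y , y∈ , refl = let (c<y , y≤) = to y∈ in m+n≤o⇒m≤o∸n 1 c<y , m≤n+o⇒m∸n≤o y c y≤
    from' : ∀ {z} → 1 ≤ z → z ≤ m → z ∈ flatten (mapLabels down U)
    from' {z} 1≤z z≤m = subst (z ∈_) (sym flatten≡)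
      (subst (_∈ map down (flatten U)) (m+n∸n≡m z c)
        (∈-map⁺ down (from (+-monoˡ-≤ c 1≤z) (subst (z + c ≤_) (+-comm m c) (+-monoˡ-≤ c z≤m)))))

SmallerInBWT : ℕ → Set
SmallerInBWT n = ∀ {m U} → m < n → RLTree m U → BWT m U

RLTree-weight1 : ∀ {T} → RLTree 1 T → BWT 1 T
RLTree-weight1 {node [] _} (rlTree _ _ _ (node ne _)) = ⊥-elim (ne refl)
RLTree-weight1 {node (_ ∷ _) (node [] _ ∷ _)} (rlTree _ _ _ (node _ (node ne _ ∷ _))) = ⊥-elim (ne refl)
RLTree-weight1 {node (v ∷ vs) (node (y ∷ ys) cc ∷ cs)} (rlTree u (to , _) _ _) =
  ⊥-elim (Unique-++-disjoint (v ∷ vs) u (here refl) (here (≡-trans (is1 (here refl)) (sym (is1 y∈)))))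
  where
  is1 : ∀ {z} → z ∈ flatten (node (v ∷ vs) (node (y ∷ ys) cc ∷ cs)) → z ≡ 1
  is1 z∈ = let (1≤z , z≤1) = to z∈ in ≤-antisym z≤1 1≤z
  y∈ : y ∈ flatten (node (v ∷ vs) (node (y ∷ ys) cc ∷ cs))
  y∈ = ∈-++⁺ʳ (v ∷ vs) (here refl)
RLTree-weight1 {node l []} (rlTree u (to , from) _ _) = iso unit (node one↭l ↭-refl [])
  where
  l≡ : l ++ [] ≡ l
  l≡ = ++-identityʳ l
  one↭l : 1 ∷ [] ↭ l
  one↭l = uniqueSameMembers⇒↭ ([] ∷ []) (subst Unique l≡ u)
            (λ { (here refl) → subst (1 ∈_) l≡ (from ≤-refl ≤-refl) })
            (λ z∈ → let (1≤z , z≤1) = to (subst (_ ∈_) (sym l≡) z∈) in here (≤-antisym z≤1 1≤z))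

-- A leaf {m+1} below the root: T = ({1}→{2}) ∘₁ T', where T' is T without
-- that leaf.
detach-leaf-max : ∀ m l cs → RLTree (suc m) (node l (leaf (suc m ∷ []) ∷ cs)) → SmallerInBWT (suc m) →
                  BWT (suc m) (node l (leaf (suc m ∷ []) ∷ cs))
detach-leaf-max m [] cs (rlTree _ _ _ (node ne _)) IH = ⊥-elim (ne refl)
detach-leaf-max m l@(_ ∷ _) cs (rlTree u sp rl (node ne (_ ∷ nes))) IH =
  subst (BWT (suc m)) decomposition (comp gen₂ (IH ≤-refl rest) ≤-refl (s≤s z≤n))
  where
  moved : flatten (node l (leaf (suc m ∷ []) ∷ cs)) ↭ suc m ∷ flatten (node l cs)
  moved = Perm.shift (suc m) l (flattenList cs)
  u' : Unique (suc m ∷ flatten (node l cs))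
  u' = Unique-resp-↭ moved u
  rest : RLTree m (mapLabels (λ y → y ∸ 0) (node l cs))
  rest = RLTree-translate-down 0 m l cs (AllPairs-tail u') (Spans-remove-max u' (Spans-↭ moved sp))
           (All.tail (RL-children rl)) (node ne nes)
  decomposition : compose 1 m (node (1 ∷ []) (leaf (2 ∷ []) ∷ [])) (mapLabels (λ y → y ∸ 0) (node l cs)) ≡
                  node l (leaf (suc m ∷ []) ∷ cs)
  decomposition = cong₂ (λ L C → node L (leaf (suc m ∷ []) ∷ C))
    (map-undo (λ y → y + 0) (λ y → y ∸ 0) l (λ {y} _ → +-identityʳ y))
    (mapLabelsList-undo (λ y → y + 0) (λ y → y ∸ 0) cs (λ {y} _ → +-identityʳ y))

-- A leaf {1} below the root: T = ({2}→{1}) ∘₂ T', where T' is T without that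
-- leaf, relabelled by y ↦ y - 1.
detach-leaf-min : ∀ m l cs → RLTree (suc m) (node l (leaf (1 ∷ []) ∷ cs)) → SmallerInBWT (suc m) →
                  BWT (suc m) (node l (leaf (1 ∷ []) ∷ cs))
detach-leaf-min m [] cs (rlTree _ _ _ (node ne _)) IH = ⊥-elim (ne refl)
detach-leaf-min m l@(_ ∷ _) cs (rlTree u sp rl (node ne (_ ∷ nes))) IH =
  subst (BWT (suc m)) decomposition (comp gen₃ (IH ≤-refl rest) (s≤s z≤n) ≤-refl)
  where
  moved : flatten (node l (leaf (1 ∷ []) ∷ cs)) ↭ 1 ∷ flatten (node l cs)
  moved = Perm.shift 1 l (flattenList cs)
  u' : Unique (1 ∷ flatten (node l cs))
  u' = Unique-resp-↭ moved u
  sp' : Spans (flatten (node l cs)) 2 (suc m)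
  sp' = Spans-remove-min u' (Spans-↭ moved sp)
  rest : RLTree m (mapLabels (λ y → y ∸ 1) (node l cs))
  rest = RLTree-translate-down 1 m l cs (AllPairs-tail u') sp' (All.tail (RL-children rl)) (node ne nes)
  restore : ∀ {y} → y ∈ flatten (node l cs) → y ∸ 1 + 1 ≡ y
  restore y∈ = m∸n+n≡m (≤-trans (n≤1+n 1) (proj₁ (proj₁ sp' y∈)))
  decomposition : compose 2 m (node (2 ∷ []) (leaf (1 ∷ []) ∷ [])) (mapLabels (λ y → y ∸ 1) (node l cs)) ≡
                  node l (leaf (1 ∷ []) ∷ cs)
  decomposition = cong₂ (λ L C → node L (leaf (1 ∷ []) ∷ C))
    (map-undo (λ y → y + 1) (λ y → y ∸ 1) l (restore ∘ ∈-++⁺ˡ))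
    (mapLabelsList-undo (λ y → y + 1) (λ y → y ∸ 1) cs (restore ∘ ∈-++⁺ʳ l))

-- The label 1 at a root carrying at least one further label:
-- T = {1,2} ∘₂ T', where T' is T without the label 1, relabelled by y ↦ y - 1.
detach-root-label1 : ∀ m w ws cs → RLTree (suc m) (node (1 ∷ w ∷ ws) cs) → SmallerInBWT (suc m) →
                     BWT (suc m) (node (1 ∷ w ∷ ws) cs)
detach-root-label1 m w ws cs (rlTree u sp rl (node _ nes)) IH =
  subst (BWT (suc m)) decomposition (comp gen₁ (IH ≤-refl rest) (s≤s z≤n) ≤-refl)
  where
  l : List ℕ
  l = w ∷ ws
  sp' : Spans (flatten (node l cs)) 2 (suc m)
  sp' = Spans-remove-min u sp
  rest : RLTree m (mapLabels (λ y → y ∸ 1) (node l cs))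
  rest = RLTree-translate-down 1 m l cs (AllPairs-tail u) sp' (RL-children rl) (node (λ ()) nes)
  restore : ∀ {y} → y ∈ flatten (node l cs) → y ∸ 1 + 1 ≡ y
  restore y∈ = m∸n+n≡m (≤-trans (n≤1+n 1) (proj₁ (proj₁ sp' y∈)))
  decomposition : compose 2 m (leaf (1 ∷ 2 ∷ [])) (mapLabels (λ y → y ∸ 1) (node l cs)) ≡ node (1 ∷ l) cs
  decomposition = cong₂ (λ L C → node (1 ∷ L) C)
    (map-undo (λ y → y + 1) (λ y → y ∸ 1) l (restore ∘ ∈-++⁺ˡ))
    (mapLabelsList-undo (λ y → y + 1) (λ y → y ∸ 1) cs (restore ∘ ∈-++⁺ʳ l))

nonEmpty⇒∈ : ∀ (L : List ℕ) → ¬ L ≡ [] → Σ ℕ (_∈ L)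
nonEmpty⇒∈ [] ne = ⊥-elim (ne refl)
nonEmpty⇒∈ (v ∷ _) _ = v , here refl

-- These labels form an
-- interval [a, b] with d = b - a > 0, and T₀ = T' ∘ₐ c', where c' is c
-- relabelled to 1, …, d+1, and T' of weight n - d is T₀ with c replaced by a
-- leaf {a} and relabelled by unshift (which lowers the labels above b by d).
module SplitBigChild (n : ℕ) (l : List ℕ) (y : ℕ) (ys : List ℕ) (cc cs : List Tree)
                     (w : ℕ) (w∈ : w ∈ ys ++ flattenList cc)
                     (rlT : RLTree n (node l (node (y ∷ ys) cc ∷ cs))) where
  open RLTree rlT

  c : Tree
  c = node (y ∷ ys) cc
  T₀ : Tree
  T₀ = node l (c ∷ cs)
  Fc : List ℕ
  Fc = flatten c
  F : List ℕ
  F = flattenList cs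

  Fc⊆T₀ : ∀ {z} → z ∈ Fc → z ∈ flatten T₀
  Fc⊆T₀ = ∈-++⁺ʳ l ∘ ∈-++⁺ˡ

  l∉Fc : ∀ {z} → z ∈ l → z ∉ Fc
  l∉Fc z∈l z∈Fc = Unique-++-disjoint l distinct z∈l (∈-++⁺ˡ z∈Fc)

  F∉Fc : ∀ {z} → z ∈ F → z ∉ Fc
  F∉Fc z∈F z∈Fc = Unique-++-disjoint Fc (Unique-++ʳ l distinct) z∈Fc z∈F

  a b : ℕ
  a = min y (ys ++ flattenList cc)
  b = max y (ys ++ flattenList cc)

  a∈Fc : a ∈ Fc
  a∈Fc with argmin-sel id y (ys ++ flattenList cc)
  ... | inj₁ a≡y = here a≡y
  ... | inj₂ a∈ = there a∈

  b∈Fc : b ∈ Fc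
  b∈Fc with argmax-sel id y (ys ++ flattenList cc)
  ... | inj₁ b≡y = here b≡y
  ... | inj₂ b∈ = there b∈

  a≤Fc : ∀ {z} → z ∈ Fc → a ≤ z
  a≤Fc (here refl) = min≤⊤ y (ys ++ flattenList cc)
  a≤Fc (there z∈) = All.lookup (min≤xs y (ys ++ flattenList cc)) z∈

  Fc≤b : ∀ {z} → z ∈ Fc → z ≤ b
  Fc≤b (here refl) = ⊥≤max y (ys ++ flattenList cc)
  Fc≤b (there z∈) = All.lookup (xs≤max y (ys ++ flattenList cc)) z∈

  Fc-spans : Spans Fc a b
  Fc-spans = (λ z∈ → a≤Fc z∈ , Fc≤b z∈) ,
             (λ a≤z z≤b → RL-interval (All.head (RL-children recursive)) a b _ a∈Fc b∈Fc a≤z z≤b)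

  -- a < b, because y and w are distinct labels of c
  a<b : a < b
  a<b = ≤∧≢⇒< (≤-trans (a≤Fc (here refl)) (Fc≤b (here refl))) a≢b
    where
    a≢b : a ≢ b
    a≢b a≡b = Unique[x∷xs]⇒x∉xs (Unique-++ˡ Fc (Unique-++ʳ l distinct))
                (subst (_∈ ys ++ flattenList cc) (sym y≡w) w∈)
      where
      squeeze : ∀ {z} → z ∈ Fc → z ≡ a
      squeeze z∈ = ≤-antisym (subst (_ ≤_) (sym a≡b) (Fc≤b z∈)) (a≤Fc z∈)
      y≡w : y ≡ w
      y≡w = ≡-trans (squeeze (here refl)) (sym (squeeze (there w∈)))

  d : ℕ
  d = b ∸ a

  a+d≡b : a + d ≡ b
  a+d≡b = m+[n∸m]≡n (<⇒≤ a<b)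

  1≤a : 1 ≤ a
  1≤a = proj₁ (proj₁ spans (Fc⊆T₀ a∈Fc))

  b≤n : b ≤ n
  b≤n = proj₂ (proj₁ spans (Fc⊆T₀ b∈Fc))

  d≤n : d ≤ n
  d≤n = ≤-trans (m∸n≤m b a) b≤n

  open Shift a d

  block⇒Fc : ∀ {z} → a ≤ z → z ≤ a + d → z ∈ Fc
  block⇒Fc a≤z z≤ = proj₂ Fc-spans a≤z (subst (_ ≤_) a+d≡b z≤)

  outside : ∀ {z} → z ∉ Fc → Outside z
  outside {z} z∉ with outside-or-block z
  ... | inj₁ out = out
  ... | inj₂ (a≤z , z≤) = ⊥-elim (z∉ (block⇒Fc a≤z z≤))

  T' : Tree
  T' = node (map unshift l) (leaf (a ∷ []) ∷ mapLabelsList unshift cs)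

  L₀ : List ℕ
  L₀ = l ++ a ∷ F

  unshift-a : unshift a ≡ a
  unshift-a = unshift-≤ ≤-refl

  flatten-T' : flatten T' ≡ map unshift L₀
  flatten-T' = begin
    map unshift l ++ a ∷ flattenList (mapLabelsList unshift cs)
      ≡⟨ cong (map unshift l ++_) (cong₂ _∷_ (sym unshift-a) (flattenList-mapLabelsList unshift cs)) ⟩
    map unshift l ++ map unshift (a ∷ F)
      ≡⟨ map-++ unshift l (a ∷ F) ⟨
    map unshift L₀ ∎
    where open ≡-Reasoning

  L₀-outside : ∀ {z} → z ∈ L₀ → Outside z
  L₀-outside z∈ with ∈-++⁻ l z∈
  ... | inj₁ z∈l = outside (l∉Fc z∈l)
  ... | inj₂ (here refl) = inj₁ ≤-refl
  ... | inj₂ (there z∈F) = outside (F∉Fc z∈F)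

  L₀⊆T₀ : ∀ {z} → z ∈ L₀ → z ∈ flatten T₀
  L₀⊆T₀ z∈ with ∈-++⁻ l z∈
  ... | inj₁ z∈l = ∈-++⁺ˡ z∈l
  ... | inj₂ (here refl) = Fc⊆T₀ a∈Fc
  ... | inj₂ (there z∈F) = ∈-++⁺ʳ l (∈-++⁺ʳ Fc z∈F)

  T₀⇒T' : ∀ {z} → z ∈ flatten T₀ → unshift z ∈ flatten T'
  T₀⇒T' {z} z∈ = subst (unshift z ∈_) (sym flatten-T') (T⇒L₀ (∈-++⁻ l z∈))
    where
    T⇒L₀ : z ∈ l ⊎ z ∈ Fc ++ F → unshift z ∈ map unshift L₀
    T⇒L₀ (inj₁ z∈l) = ∈-map⁺ unshift (∈-++⁺ˡ z∈l)
    T⇒L₀ (inj₂ z∈) with ∈-++⁻ Fc z∈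
    ... | inj₂ z∈F = ∈-map⁺ unshift (∈-++⁺ʳ l (there z∈F))
    ... | inj₁ z∈Fc = subst (_∈ map unshift L₀) (≡-trans unshift-a (sym (unshift-block (a≤Fc z∈Fc) z≤)))
                        (∈-map⁺ unshift (∈-++⁺ʳ l (here refl)))
      where
      z≤ : z ≤ a + d
      z≤ = subst (z ≤_) (sym a+d≡b) (Fc≤b z∈Fc)

  T'⇒T₀ : ∀ {z} → unshift z ∈ flatten T' → z ∈ flatten T₀
  T'⇒T₀ {z} u∈ with outside-or-block z
  ... | inj₂ (a≤z , z≤) = Fc⊆T₀ (block⇒Fc a≤z z≤)
  ... | inj₁ out with ∈-map⁻ unshift (subst (unshift z ∈_) flatten-T' u∈)
  ...   | v , v∈ , u≡ =
    subst (_∈ flatten T₀) (sym (unshift-injective-outside out (L₀-outside v∈) u≡)) (L₀⊆T₀ v∈)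

  n' : ℕ
  n' = n ∸ d

  a≤n' : a ≤ n'
  a≤n' = m+n≤o⇒m≤o∸n a (subst (_≤ n) (sym a+d≡b) b≤n)

  T'-spans : Spans (flatten T') 1 n'
  T'-spans = Spans-unshift⁻ a d n' 1≤a a≤n' (subst (Spans (flatten T₀) 1) (sym (m∸n+n≡m d≤n)) spans)
               T₀⇒T' T'⇒T₀

  L₀-distinct : Unique L₀
  L₀-distinct = Unique.++⁺ (Unique-++ˡ l distinct) (a∉F ∷ Unique-++ʳ Fc (Unique-++ʳ l distinct)) disjoint
    where
    a∉F : All (a ≢_) F
    a∉F = All.tabulate (λ z∈F a≡z → F∉Fc z∈F (subst (_∈ Fc) a≡z a∈Fc))
    disjoint : ∀ {z} → z ∈ l × z ∈ a ∷ F → ⊥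
    disjoint (z∈l , here refl) = l∉Fc z∈l a∈Fc
    disjoint (z∈l , there z∈F) = Unique-++-disjoint l distinct z∈l (∈-++⁺ʳ Fc z∈F)

  T'-rlTree : RLTree n' T'
  T'-rlTree =
    rlTree (subst Unique (sym flatten-T')
             (Unique-map unshift (λ p q → unshift-injective-outside (L₀-outside p) (L₀-outside q)) L₀-distinct))
           T'-spans
           (node (span-interval T'-spans)
                 (node (singleton-interval a) [] ∷
                  RL-mapList AllOutside unshift (λ ⊆ out → out ∘ ⊆) (unshift-interval _) cs
                             (outside ∘ F∉Fc) (All.tail (RL-children recursive))))
           (node (nonEmpty-map unshift l (AllNodes-root noEmpty))
                 (node (λ ()) [] ∷ NoEmptyNodes-mapList unshift cs (All.tail (AllNodes-children noEmpty))))
    where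
    AllOutside : List ℕ → Set
    AllOutside L = ∀ {z} → z ∈ L → Outside z

  c' : Tree
  c' = mapLabels (λ v → v ∸ (a ∸ 1)) c

  c'-rlTree : RLTree (suc d) c'
  c'-rlTree = RLTree-translate-down (a ∸ 1) (suc d) (y ∷ ys) cc (Unique-++ˡ Fc (Unique-++ʳ l distinct))
                (subst₂ (Spans Fc) (sym (m+[n∸m]≡n 1≤a)) (sym a-1+d+1≡b) Fc-spans)
                (RL-children (All.head (RL-children recursive))) (All.head (AllNodes-children noEmpty))
    where
    a-1+d+1≡b : a ∸ 1 + suc d ≡ b
    a-1+d+1≡b = ≡-trans (+-suc (a ∸ 1) d) (≡-trans (cong (_+ d) (m+[n∸m]≡n 1≤a)) a+d≡b)

  -- T₀ = T' ∘ₐ c': composition relabels T' by shift, which undoes unshift on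
  -- its labels and fixes a, and then replaces the leaf {a} by c' translated
  -- back by a - 1, which is c again.
  decomposition : compose a (suc d) T' c' ≡ T₀
  decomposition = begin
    go a S (node l' (leaf (shift a ∷ []) ∷ cs'))
      ≡⟨ cong (λ v → go a S (node l' (leaf (v ∷ []) ∷ cs'))) (shift-≤ ≤-refl) ⟩
    go a S (node l' (leaf (a ∷ []) ∷ cs'))
      ≡⟨ cong₂ (λ L C → go a S (node L (leaf (a ∷ []) ∷ C)))
               (map-undo shift unshift l (λ z∈ → shift-unshift-outside (outside (l∉Fc z∈))))
               (mapLabelsList-undo shift unshift cs (λ z∈ → shift-unshift-outside (outside (F∉Fc z∈)))) ⟩
    go a S (node l (leaf (a ∷ []) ∷ cs))
      ≡⟨ go-leaf a _ _ _ l cs (λ a∈l → l∉Fc a∈l a∈Fc) (λ a∈F → F∉Fc a∈F a∈Fc) ⟩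
    node l (S ∷ cs)
      ≡⟨ cong (λ t → node l (t ∷ cs)) (mapLabels-undo (λ v → v + (a ∸ 1)) (λ v → v ∸ (a ∸ 1)) c
                                         (λ z∈ → m∸n+n≡m (≤-trans (m∸n≤m a 1) (a≤Fc z∈)))) ⟩
    T₀ ∎
    where
    open ≡-Reasoning
    S : Tree
    S = mapLabels (λ v → v + (a ∸ 1)) c'
    l' : List ℕ
    l' = map shift (map unshift l)
    cs' : List Tree
    cs' = mapLabelsList shift (mapLabelsList unshift cs)

  weight : n' + suc d ∸ 1 ≡ n
  weight = ≡-trans (cong (_∸ 1) (+-suc n' d)) (m∸n+n≡m d≤n)

  n'<n : n' < n
  n'<n = ∸-monoʳ-< (m<n⇒0<n∸m a<b) d≤n

  -- the root carries a label outside [a, b], so c' is smaller than T₀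
  d+1<n : suc d < n
  d+1<n with nonEmpty⇒∈ l (AllNodes-root noEmpty)
  ... | v , v∈l with outside (l∉Fc v∈l) | proj₁ spans (∈-++⁺ˡ v∈l)
  ...   | inj₁ v≤a | 1≤v , _ = ≤-trans (+-monoˡ-≤ d 2≤a) (≤-trans (≤-reflexive a+d≡b) b≤n)
    where
    2≤a : 2 ≤ a
    2≤a = ≤-trans (s≤s 1≤v) (≤∧≢⇒< v≤a (λ v≡a → l∉Fc v∈l (subst (_∈ Fc) (sym v≡a) a∈Fc)))
  ...   | inj₂ a+d<v | _ , v≤n = ≤-trans (s≤s (+-monoˡ-≤ d 1≤a)) (≤-trans a+d<v v≤n)

  split : SmallerInBWT n → BWT n T₀
  split IH = subst₂ BWT weight decomposition (comp (IH n'<n T'-rlTree) (IH d+1<n c'-rlTree) 1≤a a≤n')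

mutual
  ≈-refl : ∀ t → t ≈ t
  ≈-refl (node l cs) = node ↭-refl ↭-refl (≈-reflList cs)

  ≈-reflList : ∀ cs → Pointwise _≈_ cs cs
  ≈-reflList [] = []
  ≈-reflList (c ∷ cs) = ≈-refl c ∷ ≈-reflList cs

bring-child-forward : ∀ l {cs c} → c ∈ cs →
                      Σ (List Tree) λ rest → (node l cs ≈ node l (c ∷ rest)) × (node l (c ∷ rest) ≈ node l cs)
bring-child-forward l {c = c} c∈ with ∈-∃++ c∈
... | as , bs , refl = as ++ bs , node ↭-refl (Perm.shift c as bs) (≈-reflList _) ,
                                  node ↭-refl (↭-sym (Perm.shift c as bs)) (≈-reflList _)

bring-label-forward : ∀ {l} cs {v : ℕ} → v ∈ l →
                      Σ (List ℕ) λ rest → (l ↭ v ∷ rest) ×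
                        (node l cs ≈ node (v ∷ rest) cs) × (node (v ∷ rest) cs ≈ node l cs)
bring-label-forward cs {v} v∈ with ∈-∃++ v∈
... | as , bs , refl = as ++ bs , Perm.shift v as bs , node (Perm.shift v as bs) ↭-refl (≈-reflList cs) ,
                                  node (↭-sym (Perm.shift v as bs)) ↭-refl (≈-reflList cs)

data Big : Tree → Set where
  big : ∀ {y ys cc w} → w ∈ ys ++ flattenList cc → Big (node (y ∷ ys) cc)

IsSmallLeaf : Tree → Set
IsSmallLeaf c = Σ ℕ λ y → c ≡ leaf (y ∷ [])

big-or-small : ∀ t → NoEmptyNodes t → Big t ⊎ IsSmallLeaf t
big-or-small (node [] _) (node ne _) = ⊥-elim (ne refl)
big-or-small (node (y ∷ w ∷ ys) cc) _ = inj₁ (big (here refl))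
big-or-small (node (y ∷ []) []) _ = inj₂ (y , refl)
big-or-small (node (y ∷ []) (node [] _ ∷ _)) (node _ (node ne _ ∷ _)) = ⊥-elim (ne refl)
big-or-small (node (y ∷ []) (node (w ∷ _) _ ∷ _)) _ = inj₁ (big (here refl))

some-big-or-all-small : ∀ cs → All NoEmptyNodes cs → Any Big cs ⊎ All IsSmallLeaf cs
some-big-or-all-small [] [] = inj₂ []
some-big-or-all-small (c ∷ cs) (ne ∷ nes) with big-or-small c ne | some-big-or-all-small cs nes
... | inj₁ b | _ = inj₁ (here b)
... | inj₂ _ | inj₁ someBig = inj₁ (there someBig)
... | inj₂ s | inj₂ allSmall = inj₂ (s ∷ allSmall)

leaf-or-absent : ∀ v cs → All IsSmallLeaf cs → leaf (v ∷ []) ∈ cs ⊎ v ∉ flattenList cs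
leaf-or-absent v [] [] = inj₂ (λ ())
leaf-or-absent v (_ ∷ cs) ((y , refl) ∷ allSmall) with y ≟ v | leaf-or-absent v cs allSmall
... | yes refl | _ = inj₁ (here refl)
... | no _ | inj₁ v∈ = inj₁ (there v∈)
... | no y≢v | inj₂ v∉ = inj₂ λ { (here v≡y) → y≢v (sym v≡y) ; (there v∈) → v∉ v∈ }

label-in-root : ∀ {n l cs z} → RLTree n (node l cs) → 1 ≤ z → z ≤ n → z ∉ flattenList cs → z ∈ l
label-in-root {l = l} rl 1≤z z≤top z∉ = [ id , ⊥-elim ∘ z∉ ] (∈-++⁻ l (proj₂ (RLTree.spans rl) 1≤z z≤top))

-- Only single-label leaves as children, none of them {1} or {m+2}: the root
-- carries 1 and m+2; moving 1 to the front, m+2 ≠ 1 remains among the other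
-- root labels, so 1 can be detached from the root.
root-carries-extremes : ∀ m l cs → RLTree (suc (suc m)) (node l cs) → SmallerInBWT (suc (suc m)) →
                        1 ∉ flattenList cs → suc (suc m) ∉ flattenList cs → BWT (suc (suc m)) (node l cs)
root-carries-extremes m l cs rl IH 1∉ n∉
  with bring-label-forward cs (label-in-root rl ≤-refl (s≤s z≤n) 1∉)
... | rest , l↭ , to-front , back with Perm.∈-resp-↭ l↭ (label-in-root rl (s≤s z≤n) ≤-refl n∉)
...   | there n∈rest with rest | n∈rest
...     | w ∷ ws | _ = iso (detach-root-label1 (suc m) w ws cs (RLTree-≈ to-front rl) IH) back

decompose : ∀ m T → RLTree (suc (suc m)) T → SmallerInBWT (suc (suc m)) → BWT (suc (suc m)) T
decompose m (node l cs) rl IH with some-big-or-all-small cs (AllNodes-children (RLTree.noEmpty rl))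
... | inj₁ someBig with find someBig
...   | _ , c∈ , big {y} {ys} {cc} {w} w∈ with bring-child-forward l c∈
...     | rest , to-front , back = iso (SplitBigChild.split _ l y ys cc rest w w∈ (RLTree-≈ to-front rl) IH) back
decompose m (node l cs) rl IH | inj₂ allSmall with leaf-or-absent 1 cs allSmall
... | inj₁ leaf1∈ with bring-child-forward l leaf1∈
...   | rest , to-front , back = iso (detach-leaf-min (suc m) l rest (RLTree-≈ to-front rl) IH) back
decompose m (node l cs) rl IH | inj₂ allSmall | inj₂ 1∉ with leaf-or-absent (suc (suc m)) cs allSmall
... | inj₁ leafn∈ with bring-child-forward l leafn∈
...   | rest , to-front , back = iso (detach-leaf-max (suc m) l rest (RLTree-≈ to-front rl) IH) back
decompose m (node l cs) rl IH | inj₂ allSmall | inj₂ 1∉ | inj₂ n∉ = root-carries-extremes m l cs rl IH 1∉ n∉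

RLTree⇒BWT : ∀ n T → RLTree n T → BWT n T
RLTree⇒BWT = <-rec (λ n → ∀ T → RLTree n T → BWT n T) step
  where
  step : ∀ n → (∀ {m} → m < n → ∀ T → RLTree m T → BWT m T) → ∀ T → RLTree n T → BWT n T
  step zero _ T rl = ⊥-elim (RLTree-weight0 rl)
  step (suc zero) _ T rl = RLTree-weight1 rl
  step (suc (suc m)) smaller T rl = decompose m T rl (λ m<n → smaller m<n _)

mainTheorem10 : (n : ℕ) (T : Tree) → WellFormed n T →
    (BWT n T ⇔ (RecursivelyLabelled T × NoEmptyNodes T))
mainTheorem10 n T wf = mk⇔ sound complete
  where
  sound : BWT n T → RecursivelyLabelled T × NoEmptyNodes T
  sound b = let open Admissible (BWT⇒admissible b) in recursive , noEmpty
  complete : RecursivelyLabelled T × NoEmptyNodes T → BWT n T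
  complete (rl , ne) = RLTree⇒BWT n T (wellFormed⇒RLTree wf rl ne)
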